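{- Let $\beta>1$ be a Parry number and $L$ the language of $U_\beta$ (as in the context). Let $u,v\in L$ be non-empty words such that $(u,v)$ satisfies condition $(\star)$. Then $$\binom{u0^{p(u,v)}w}{v0^{p(u,v)}w}\equiv1\pmod2\quad\text{for all } w\in0^*L.$$
   Context: For finite words $u,v$, $\binom{u}{v}$ is the number of occurrences of $v$ as a (scattered) subsequence of $u$; $\varepsilon$ is the empty word; $|w|$ the length. For a set of words $K$, $u^{ -1}.K=\{w:uw\in K\}$; $0^*L=\{0^iw:i\ge0,w\in L\}$. Let $\beta>1$ be real and $A_\beta=\{0,1,\ldots,\lceil\beta\rceil-1\}$. Every $x\in[0,1)$ has a greedy $\beta$-expansion $d_\beta(x)=c_1c_2\cdots$ over $A_\beta$ with $x=\sum_{j\ge1}c_j\beta^{ -j}$ and $\sum_{i\ge j}c_i\beta^{ -i}<\beta^{ -j+1}$ for all $j\ge1$. The $\beta$-expansion of $1$ is $d_\beta(1)=(\beta-1)^\omega$ if $\beta\in\mathbb{N}$, and otherwise $d_\beta(1)=(\lceil\beta\rceil-1)\,d_\beta\big(1-(\lceil\beta\rceil-1)/\beta\big)$. $\beta$ is a Parry number if $d_\beta(1)$ is ultimately periodic. Define $U_\beta=(U_\beta(n))_{n\ge0}$: if $d_\beta(1)=t_1\cdots t_m0^\omega$ ($t_m\ne0$), set $U_\beta(0)=1$, $U_\beta(i)=t_1U_\beta(i-1)+\cdots+t_iU_\beta(0)+1$ for $1\le i\le m-1$, and $U_\beta(n)=t_1U_\beta(n-1)+\cdots+t_mU_\beta(n-m)$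 for $n\ge m$; if $d_\beta(1)=t_1\cdots t_m(t_{m+1}\cdots t_{m+k})^\omega$ with $m,k$ minimal (and not of the previous form), set $U_\beta(0)=1$, $U_\beta(i)=t_1U_\beta(i-1)+\cdots+t_iU_\beta(0)+1$ for $1\le i\le m+k-1$, and for $n\ge m+k$, $U_\beta(n)=t_1U_\beta(n-1)+\cdots+t_{m+k}U_\beta(n-m-k)+U_\beta(n-k)-t_1U_\beta(n-k-1)-\cdots-t_mU_\beta(n-m-k)$. For $n\ge1$, $\mathrm{rep}_{U_\beta}(n)$ is the greedy representation $c_{\ell-1}\cdots c_0$ with $n=\sum_jc_jU_\beta(j)$, $c_{\ell-1}\ne0$, and $\mathrm{rep}_{U_\beta}(0)=\varepsilon$. $L=\mathrm{rep}_{U_\beta}(\mathbb{N})$. For non-empty $u,v\in L$, $p(u,v)$ is the smallest non-negative integer $p$ with $(u0^p)^{ -1}.L=(v0^p)^{ -1}.L=0^*L$ (it exists); $p(\varepsilon,\varepsilon)=0$. A pair $(u,v)\in L\times L$ satisfies $(\star)$ if either $u=v=\varepsilon$, or $|u|\ge|v|>0$ and, with $p=p(u,v)$, $\binom{u0^p}{v0^p}\equiv1\pmod2$ and $\binom{u0^p}{v0^pa}=0$ for all $a\in A_\beta$. -}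

module Defs where

open import Data.Nat using (ℕ; zero; suc; _+_; _*_; _∸_; _≤_; _<_; _≡ᵇ_)
open import Data.Nat.DivMod using (_%_)
open import Data.Bool using (if_then_else_)
open import Data.List using (List; []; _∷_; _++_; length; reverse; replicate)
open import Data.Product using (_×_; ∃; Σ)
open import Data.Sum using (_⊎_)
open import Data.Unit using (⊤)
open import Relation.Nullary using (¬_)
open import Relation.Binary.PropositionalEquality using (_≡_; _≢_)

Word : Set
Word = List ℕ

binom : Word → Word → ℕ
binom u        []       = 1
binom []       (b ∷ v)  = 0
binom (a ∷ u)  (b ∷ v)  = binom u (b ∷ v) + (if a ≡ᵇ b then binom u v else 0)

zeros : ℕ → Word
zeros p = replicate p 0

-- The sequence d_β(1) = t₁ t₂ t₃ ⋯ is encoded as d : ℕ → ℕ with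
-- d i = t_{i+1}  (0-indexed).

LexLt : (ℕ → ℕ) → (ℕ → ℕ) → Set
LexLt a b = ∃ λ n → (∀ i → i < n → a i ≡ b i) × a n < b n

shift : ℕ → (ℕ → ℕ) → (ℕ → ℕ)
shift n d i = d (n + i)

-- Parry's condition: the greedy β-expansion of 1 for some real β > 1
ParryAdmissible : (ℕ → ℕ) → Set
ParryAdmissible d =
  (1 ≤ d 0) ×
  (∀ n → 1 ≤ n → LexLt (shift n d) d) ×
  ¬ (d 0 ≡ 1 × (∀ i → 1 ≤ i → d i ≡ 0))

-- d is d_β(1) for some real β > 1, with the convention of the paper
-- (d_β(1) = (β-1)^ω for integer β).  Via Parry's theorem:
--   non-integer β  ↔  Parry-admissible and not of the form N 0^ω,
--   integer β = N+1 ≥ 2  ↔  d = N^ω with N ≥ 1.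
IsDBeta1 : (ℕ → ℕ) → Set
IsDBeta1 d =
  (ParryAdmissible d × ¬ (∃ λ N → (2 ≤ N) × (d 0 ≡ N) × (∀ i → 1 ≤ i → d i ≡ 0)))
  ⊎ (∃ λ N → (1 ≤ N) × (∀ i → d i ≡ N))

-- d = t₁⋯t_m (t_{m+1}⋯t_{m+k})^ω
Periodic : (ℕ → ℕ) → ℕ → ℕ → Set
Periodic d m k = (1 ≤ k) × (∀ i → m ≤ i → d (i + k) ≡ d i)

IsParryNumber : (ℕ → ℕ) → Set
IsParryNumber d = ∃ λ m → ∃ λ k → Periodic d m k

MinPeriodic : (ℕ → ℕ) → ℕ → ℕ → Set
MinPeriodic d m k =
  Periodic d m k × (∀ m' k' → Periodic d m' k' → (m ≤ m') × (k ≤ k'))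

-- d = t₁⋯t_m 0^ω with t_m ≠ 0
FiniteAt : (ℕ → ℕ) → ℕ → Set
FiniteAt d m = (1 ≤ m) × (d (m ∸ 1) ≢ 0) × (∀ i → m ≤ i → d i ≡ 0)

sumTo : ℕ → (ℕ → ℕ) → ℕ
sumTo zero    f = 0
sumTo (suc n) f = sumTo n f + f n

-- conv d U n r = t₁ U(n-1) + ⋯ + t_r U(n-r)
conv : (ℕ → ℕ) → (ℕ → ℕ) → ℕ → ℕ → ℕ
conv d U n r = sumTo r (λ j → d j * U (n ∸ suc j))

FinRec : (ℕ → ℕ) → ℕ → (ℕ → ℕ) → Set
FinRec d m U =
  (U 0 ≡ 1) ×
  (∀ i → 1 ≤ i → i < m → U i ≡ conv d U i i + 1) ×
  (∀ n → m ≤ n → U n ≡ conv d U n m)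

-- U(n) = t₁U(n-1)+⋯+t_{m+k}U(n-m-k) + U(n-k) - t₁U(n-k-1) - ⋯ - t_mU(n-m-k),
-- written without truncated subtraction
PerRec : (ℕ → ℕ) → ℕ → ℕ → (ℕ → ℕ) → Set
PerRec d m k U =
  (U 0 ≡ 1) ×
  (∀ i → 1 ≤ i → i < m + k → U i ≡ conv d U i i + 1) ×
  (∀ n → m + k ≤ n → U n + conv d U (n ∸ k) m ≡ conv d U n (m + k) + U (n ∸ k))

IsU : (ℕ → ℕ) → (ℕ → ℕ) → Set
IsU d U =
  (∀ m → FiniteAt d m → FinRec d m U) ×
  (∀ m k → ¬ (∃ λ m' → FiniteAt d m') → MinPeriodic d m k → PerRec d m k U)

-- dig w i : the i-th element of w (0 if out of range)
dig : Word → ℕ → ℕ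
dig []       _       = 0
dig (x ∷ xs) zero    = x
dig (x ∷ xs) (suc i) = dig xs i

-- for w = c_{ℓ-1}⋯c₀ : low U w j = Σ_{i<j} c_i U(i)
low : (ℕ → ℕ) → Word → ℕ → ℕ
low U w j = sumTo j (λ i → dig (reverse w) i * U i)

LeadingNonzero : Word → Set
LeadingNonzero []      = ⊤
LeadingNonzero (x ∷ _) = x ≢ 0

IsGreedyRep : (ℕ → ℕ) → ℕ → Word → Set
IsGreedyRep U n w =
  (low U w (length w) ≡ n) ×
  LeadingNonzero w ×
  (∀ j → j ≤ length w → low U w j < U j)

InL : (ℕ → ℕ) → Word → Set
InL U w = ∃ λ n → IsGreedyRep U n w

InZL : (ℕ → ℕ) → Word → Set
InZL U w = ∃ λ i → ∃ λ w' → InL U w' × (w ≡ zeros i ++ w')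

QuotEq : (ℕ → ℕ) → Word → ℕ → Set
QuotEq U x p = ∀ w → (InL U (x ++ zeros p ++ w) → InZL U w) × (InZL U w → InL U (x ++ zeros p ++ w))

IsP : (ℕ → ℕ) → Word → Word → ℕ → Set
IsP U u v p =
  (QuotEq U u p × QuotEq U v p) ×
  (∀ q → q < p → ¬ (QuotEq U u q × QuotEq U v q))

-- condition (⋆); A_β = {0,…,⌈β⌉-1} = {0,…,t₁}
Star : (ℕ → ℕ) → (ℕ → ℕ) → Word → Word → Set
Star d U u v =
  (u ≡ [] × v ≡ [])
  ⊎ ((length v ≤ length u) × (0 < length v) ×
     ∃ λ p → IsP U u v p ×
       (binom (u ++ zeros p) (v ++ zeros p) % 2 ≡ 1) ×
       (∀ a → a ≤ d 0 → binom (u ++ zeros p) (v ++ zeros p ++ a ∷ []) ≡ 0))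

{-# OPTIONS --safe #-}
-- Since p(u,v) is unique, (⋆) says that no word v0^p a with a digit a ≤ t₁ occurs in u0^p.
-- Then appending a word w over {0,…,t₁} to both u0^p and v0^p leaves the number of
-- occurrences unchanged: every occurrence of v0^p w in u0^p w matches w with the appended
-- copy. So it suffices that words of 0*L use only digits ≤ t₁, i.e. U(n+1) ≤ (t₁+1)U(n).
-- For this, U(n) = s₁U(n−1) + ⋯ + s_nU(0) + 1 for all n, where s is d_β(1) if it is infinite
-- and the quasi-greedy expansion d*_β(1) if it is finite; Parry's condition makes s
-- lexicographically at least each of its shifts, and induction on n then gives
-- s_{j+1}U(n−1) + ⋯ + s_{j+n}U(0) < U(n) for every j, whence U(n+1) ≤ s₁U(n) + U(n).
module Submission where

open import Defs
open import Data.Nat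
  using (ℕ; zero; suc; pred; NonZero; ≢-nonZero; >-nonZero; _+_; _*_; _∸_; _≤_; _<_; _≡ᵇ_;
         z≤n; s≤s; z<s)
open import Data.Nat.Properties
open import Algebra.Properties.CommutativeSemigroup +-commutativeSemigroup using (xy∙z≈xz∙y)
open import Data.Bool using (true; false; if_then_else_)
open import Data.List using ([]; _∷_; _++_; length; reverse)
open import Data.List.Properties using (length-++; length-reverse; ++-assoc)
open import Data.List.Membership.Propositional using (_∈_)
open import Data.List.Relation.Unary.All as All using (All; []; _∷_)
open import Data.List.Relation.Unary.All.Properties using (++⁺; replicate⁺)
open import Data.List.Relation.Unary.Any using (here; there)
open import Data.List.Relation.Unary.Any.Properties using (reverse⁺)
open import Data.Product using (_×_; _,_; ∃; ∃₂; proj₁; proj₂)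
open import Function using (_∘_)
open import Data.Sum using (_⊎_; inj₁; inj₂)
open import Data.Nat.Induction using (<-rec)
open import Relation.Binary.Definitions using (tri<; tri≈; tri>)
open import Relation.Nullary using (¬_; contradiction; Dec; yes; no; does; ¬?)
open import Relation.Nullary.Decidable using (dec-true; dec-false; _→-dec_; decidable-stable)
open import Data.Nat.Tactic.RingSolver using (solve-∀)
open import Data.Nat.DivMod using (_%_; m<n⇒m%n≡m; [m+n]%n≡m%n; %-distribˡ-+; m%n%n≡m%n; m%n<n)
open import Relation.Binary.PropositionalEquality

-- Occurrences of subwords

length<⇒binom≡0 : ∀ u v → length u < length v → binom u v ≡ 0
length<⇒binom≡0 []      (b ∷ v) _ = refl
length<⇒binom≡0 (a ∷ u) (b ∷ v) (s≤s |u|<|v|) with a ≡ᵇ b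
... | true  = cong₂ _+_ (length<⇒binom≡0 u (b ∷ v) (m<n⇒m<1+n |u|<|v|)) (length<⇒binom≡0 u v |u|<|v|)
... | false = cong (_+ 0) (length<⇒binom≡0 u (b ∷ v) (m<n⇒m<1+n |u|<|v|))

binom-self : ∀ w → binom w w ≡ 1
binom-self []      = refl
binom-self (a ∷ w) with a ≡ᵇ a | ≡⇒≡ᵇ a a refl
... | true | _ = cong₂ _+_ (length<⇒binom≡0 w (a ∷ w) ≤-refl) (binom-self w)

binom-++-common-suffix : ∀ x y w → All (λ a → binom x (y ++ a ∷ []) ≡ 0) w →
                         binom (x ++ w) (y ++ w) ≡ binom x y
binom-++-common-suffix []      []      w _ = binom-self w
binom-++-common-suffix []      (b ∷ y) w _ =
  length<⇒binom≡0 w (b ∷ y ++ w) (s≤s (subst (length w ≤_) (sym (length-++ y)) (m≤n+m _ _)))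
binom-++-common-suffix (c ∷ x) []      []      _ = refl
binom-++-common-suffix (c ∷ x) []      (a ∷ w) (ca≡0 ∷ no-ext) with c ≡ᵇ a
... | true  = contradiction ca≡0 (m+1+n≢0 (binom x (a ∷ [])))
... | false = trans (+-identityʳ _)
                (binom-++-common-suffix x [] (a ∷ w)
                  (m+n≡0⇒m≡0 _ ca≡0 ∷ All.map (m+n≡0⇒m≡0 _) no-ext))
binom-++-common-suffix (c ∷ x) (b ∷ y) w no-ext with c ≡ᵇ b
... | true  = cong₂ _+_ (binom-++-common-suffix x (b ∷ y) w (All.map (m+n≡0⇒m≡0 _) no-ext))
                        (binom-++-common-suffix x y w (All.map (m+n≡0⇒n≡0 _) no-ext))
... | false = cong (_+ 0) (binom-++-common-suffix x (b ∷ y) w (All.map (m+n≡0⇒m≡0 _) no-ext))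

-- Digits of greedy representations

∈⇒dig : ∀ {x} r → x ∈ r → ∃ λ j → j < length r × dig r j ≡ x
∈⇒dig (y ∷ r) (here refl)  = 0 , s≤s z≤n , refl
∈⇒dig (y ∷ r) (there x∈r) with ∈⇒dig r x∈r
... | j , j<|r| , dig≡x = suc j , s≤s j<|r| , dig≡x

L-digits-≤ : ∀ {U t w} → (∀ j → U (suc j) ≤ suc t * U j) → InL U w → All (_≤ t) w
L-digits-≤ {U} {t} {w} growth (_ , _ , _ , greedy) = All.tabulate digit-≤
  where
  digit-≤ : ∀ {x} → x ∈ w → x ≤ t
  digit-≤ x∈w with ∈⇒dig (reverse w) (reverse⁺ x∈w)
  ... | j , j<|w| , refl = m<1+n⇒m≤n (*-cancelʳ-< (U j) _ (suc t) (begin-strict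
    dig (reverse w) j * U j  ≤⟨ m≤n+m _ (low U w j) ⟩
    low U w (suc j)          <⟨ greedy (suc j) (subst (j <_) (length-reverse w) j<|w|) ⟩
    U (suc j)                ≤⟨ growth j ⟩
    suc t * U j              ∎))
    where open ≤-Reasoning

0*L-digits-≤ : ∀ {U t w} → (∀ j → U (suc j) ≤ suc t * U j) → InZL U w → All (_≤ t) w
0*L-digits-≤ growth (i , w′ , w′∈L , refl) = ++⁺ (replicate⁺ i z≤n) (L-digits-≤ growth w′∈L)

-- Convolutions and lexicographic domination

sumTo-cong : ∀ n {f g : ℕ → ℕ} → (∀ i → i < n → f i ≡ g i) → sumTo n f ≡ sumTo n g
sumTo-cong zero    _   = refl
sumTo-cong (suc n) f≡g = cong₂ _+_ (sumTo-cong n (λ i i<n → f≡g i (m<n⇒m<1+n i<n))) (f≡g n ≤-refl)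

sumTo-+ : ∀ m n f → sumTo (m + n) f ≡ sumTo m f + sumTo n (λ i → f (m + i))
sumTo-+ m zero    f = trans (cong (λ k → sumTo k f) (+-identityʳ m)) (sym (+-identityʳ _))
sumTo-+ m (suc n) f = begin
  sumTo (m + suc n) f                                ≡⟨ cong (λ k → sumTo k f) (+-suc m n) ⟩
  sumTo (m + n) f + f (m + n)                        ≡⟨ cong (_+ f (m + n)) (sumTo-+ m n f) ⟩
  sumTo m f + sumTo n (λ i → f (m + i)) + f (m + n)  ≡⟨ +-assoc (sumTo m f) _ _ ⟩
  sumTo m f + sumTo (suc n) (λ i → f (m + i))        ∎
  where open ≡-Reasoning

AgreeBelow : ℕ → (ℕ → ℕ) → (ℕ → ℕ) → Set
AgreeBelow n a b = ∀ i → i < n → a i ≡ b i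

conv-cong : ∀ {a b} U n r → AgreeBelow r a b → conv a U n r ≡ conv b U n r
conv-cong U n r a≡b = sumTo-cong r (λ i i<r → cong (_* U (n ∸ suc i)) (a≡b i i<r))

conv-split : ∀ a U r q → conv a U (r + q) (r + q) ≡ conv a U (r + q) r + conv (shift r a) U q q
conv-split a U r q = trans (sumTo-+ r q _) (cong (conv a U (r + q) r +_) (sumTo-cong q tail-index))
  where
  tail-index : ∀ i → i < q → a (r + i) * U (r + q ∸ suc (r + i)) ≡ a (r + i) * U (q ∸ suc i)
  tail-index i _ = cong (λ k → a (r + i) * U k)
    (trans (cong (r + q ∸_) (sym (+-suc r i))) ([m+n]∸[m+o]≡n∸o r q (suc i)))

conv-split-at : ∀ a U r q → conv a U (suc r + q) (suc r + q) ≡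
                conv a U (suc r + q) r + a r * U q + conv (shift (suc r) a) U q q
conv-split-at a U r q = trans (conv-split a U (suc r) q)
  (cong (λ k → conv a U (suc r + q) r + a r * U k + conv (shift (suc r) a) U q q) (m+n∸m≡n r q))

shift-shift : ∀ a j k i → shift k (shift j a) i ≡ shift (j + k) a i
shift-shift a j k i = cong a (sym (+-assoc j k i))

LexLe : (ℕ → ℕ) → (ℕ → ℕ) → Set
LexLe a b = (∀ i → a i ≡ b i) ⊎ LexLt a b

DominatesShifts : (ℕ → ℕ) → Set
DominatesShifts s = ∀ j → LexLe (shift j s) s

LexLtWithin : ℕ → (ℕ → ℕ) → (ℕ → ℕ) → Set
LexLtWithin r a b = ∃ λ n → n < r × AgreeBelow n a b × a n < b n

LexLe-at : ∀ {a b} → LexLe a b → ∀ r → LexLtWithin r a b ⊎ (AgreeBelow r a b × a r ≤ b r)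
LexLe-at (inj₁ a≡b) r = inj₂ ((λ i _ → a≡b i) , ≤-reflexive (a≡b r))
LexLe-at (inj₂ (n , agree , aₙ<bₙ)) r with <-cmp n r
... | tri< n<r _ _    = inj₁ (n , n<r , agree , aₙ<bₙ)
... | tri≈ _ refl _   = inj₂ (agree , <⇒≤ aₙ<bₙ)
... | tri> _ _ r<n    = inj₂ ((λ i i<r → agree i (<-trans i<r r<n)) , ≤-reflexive (agree r r<n))

ConvRec : (ℕ → ℕ) → (ℕ → ℕ) → Set
ConvRec s U = ∀ n → U n ≡ conv s U n n + 1

conv<U : ∀ {s U} → ConvRec s U → ∀ n → conv s U n n < U n
conv<U {s} {U} rec n = subst (conv s U n n <_) (sym (rec n)) (m<m+n _ z<s)

-- At the first index r where shift j s drops below s, the tail of the convolution beyond r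
-- is again a shifted convolution, of smaller length.
shifted-conv<U : ∀ {s U} → ConvRec s U → DominatesShifts s → ∀ n j → conv (shift j s) U n n < U n
shifted-conv<U {s} {U} rec dom = <-rec _ bound
  where
  bound : ∀ n → (∀ {n′} → n′ < n → ∀ j → conv (shift j s) U n′ n′ < U n′) →
          ∀ j → conv (shift j s) U n n < U n
  bound n ih j with LexLe-at (dom j) n
  ... | inj₂ (agree , _) = subst (_< U n) (sym (conv-cong U n n agree)) (conv<U {s} rec n)
  ... | inj₁ (r , r<n , agree , s[j+r]<s[r]) with m≤n⇒∃[o]m+o≡n r<n
  ... | q , refl = begin-strict
    conv (shift j s) U n n
      ≡⟨ conv-split-at (shift j s) U r q ⟩
    conv (shift j s) U n r + s (j + r) * U q + conv (shift (suc r) (shift j s)) U q q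
      ≡⟨ cong₂ (λ x y → x + s (j + r) * U q + y)
               (conv-cong U n r agree) (conv-cong U q q (λ i _ → shift-shift s j (suc r) i)) ⟩
    S + s (j + r) * U q + conv (shift (j + suc r) s) U q q
      <⟨ +-monoʳ-< (S + s (j + r) * U q) (ih (m<n+m q z<s) (j + suc r)) ⟩
    S + s (j + r) * U q + U q
      ≡⟨ trans (+-assoc S _ _) (cong (S +_) (+-comm (s (j + r) * U q) (U q))) ⟩
    S + suc (s (j + r)) * U q
      ≤⟨ +-monoʳ-≤ S (*-monoˡ-≤ (U q) s[j+r]<s[r]) ⟩
    S + s r * U q
      ≤⟨ m≤m+n _ _ ⟩
    S + s r * U q + conv (shift (suc r) s) U q q
      ≡⟨ conv-split-at s U r q ⟨
    conv s U n n
      <⟨ conv<U {s} rec n ⟩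
    U n ∎
    where
    open ≤-Reasoning
    S : ℕ
    S = conv s U n r

ConvRec⇒U-growth : ∀ {s U t} → ConvRec s U → DominatesShifts s → s 0 ≤ t →
                 ∀ n → U (suc n) ≤ suc t * U n
ConvRec⇒U-growth {s} {U} {t} rec dom s₀≤t n = begin
  U (suc n)                                  ≡⟨ rec (suc n) ⟩
  conv s U (suc n) (suc n) + 1               ≡⟨ cong (_+ 1) (conv-split-at s U 0 n) ⟩
  s 0 * U n + conv (shift 1 s) U n n + 1     ≡⟨ +-assoc (s 0 * U n) _ 1 ⟩
  s 0 * U n + (conv (shift 1 s) U n n + 1)   ≤⟨ +-monoʳ-≤ (s 0 * U n) tail≤ ⟩
  s 0 * U n + U n                            ≤⟨ +-monoˡ-≤ (U n) (*-monoˡ-≤ (U n) s₀≤t) ⟩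
  t * U n + U n                              ≡⟨ +-comm (t * U n) (U n) ⟩
  suc t * U n                                ∎
  where
  open ≤-Reasoning
  tail≤ : conv (shift 1 s) U n n + 1 ≤ U n
  tail≤ = subst (_≤ U n) (+-comm 1 _) (shifted-conv<U {s} rec dom n 1)

-- The recurrences of U_β

ConvRec-by-induction : ∀ {s U} M → U 0 ≡ 1 → (∀ i → 1 ≤ i → i < M → U i ≡ conv s U i i + 1) →
  (∀ q → (∀ {n} → n < M + q → U n ≡ conv s U n n + 1) →
         U (M + q) ≡ conv s U (M + q) (M + q) + 1) →
  ConvRec s U
ConvRec-by-induction {s} {U} M U₀≡1 initial large = <-rec _ step
  where
  step : ∀ n → (∀ {n′} → n′ < n → U n′ ≡ conv s U n′ n′ + 1) → U n ≡ conv s U n n + 1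
  step zero    _  = U₀≡1
  step (suc n) ih with suc n <? M
  ... | yes n<M = initial (suc n) (s≤s z≤n) n<M
  ... | no  n≮M with m≤n⇒∃[o]m+o≡n (≮⇒≥ n≮M)
  ... | q , M+q≡n = subst (λ k → U k ≡ conv s U k k + 1) M+q≡n
                      (large q (λ {n′} n′<M+q → ih (subst (n′ <_) M+q≡n n′<M+q)))

-- Since d (m + k + i) = d (m + i), the tail beyond m + k of the convolution at n is the tail
-- beyond m of the convolution at n − k, to which the induction hypothesis applies.
PerRec⇒ConvRec : ∀ {d m k U} → Periodic d m k → PerRec d m k U → ConvRec d U
PerRec⇒ConvRec {d} {m} {k} {U} (1≤k , per) (U₀≡1 , initial , rec) =
  ConvRec-by-induction {d} (m + k) U₀≡1 initial large
  where
  large : ∀ q → (∀ {n} → n < m + k + q → U n ≡ conv d U n n + 1) →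
          U (m + k + q) ≡ conv d U (m + k + q) (m + k + q) + 1
  large q ih = +-cancelʳ-≡ D _ _ (begin
    U n + D                   ≡⟨ cong (λ x → U n + conv d U x m) n∸k≡m+q ⟨
    U n + conv d U (n ∸ k) m  ≡⟨ rec n (m≤m+n _ q) ⟩
    C + U (n ∸ k)             ≡⟨ cong (λ x → C + U x) n∸k≡m+q ⟩
    C + U (m + q)             ≡⟨ cong (C +_) (ih (+-monoˡ-< q (m<m+n m 1≤k))) ⟩
    C + (conv d U (m + q) (m + q) + 1)  ≡⟨ cong (λ x → C + (x + 1)) (conv-split d U m q) ⟩
    C + (D + Y + 1)           ≡⟨ rearrange C D Y ⟩
    C + Y + 1 + D             ≡⟨ cong (λ x → C + x + 1 + D) (conv-cong U q q periodic-tail) ⟨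
    C + conv (shift (m + k) d) U q q + 1 + D  ≡⟨ cong (λ x → x + 1 + D) (conv-split d U (m + k) q) ⟨
    conv d U n n + 1 + D      ∎)
    where
    open ≡-Reasoning
    n C D Y : ℕ
    n = m + k + q
    C = conv d U n (m + k)
    D = conv d U (m + q) m
    Y = conv (shift m d) U q q
    n∸k≡m+q : n ∸ k ≡ m + q
    n∸k≡m+q = trans (cong (_∸ k) (xy∙z≈xz∙y m k q)) (m+n∸n≡m (m + q) k)
    periodic-tail : AgreeBelow q (shift (m + k) d) (shift m d)
    periodic-tail i _ = trans (cong d (xy∙z≈xz∙y m k i)) (per (m + i) (m≤m+n m i))
    rearrange : ∀ c x y → c + (x + y + 1) ≡ c + y + 1 + x
    rearrange = solve-∀

lowerLast : (ℕ → ℕ) → ℕ → ℕ → ℕ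
lowerLast d ℓ r = if does (r ≟ ℓ) then pred (d r) else d r

-- For d = d_β(1) = t₁ ⋯ t_{ℓ+1} 0^ω this is d*_β(1) = (t₁ ⋯ t_ℓ (t_{ℓ+1} − 1))^ω.

quasiGreedy : (ℕ → ℕ) → ℕ → ℕ → ℕ
quasiGreedy d ℓ i = lowerLast d ℓ (i % suc ℓ)

lowerLast-≤ : ∀ d ℓ r → lowerLast d ℓ r ≤ d r
lowerLast-≤ d ℓ r with does (r ≟ ℓ)
... | true  = pred[n]≤n
... | false = ≤-refl

quasiGreedy-< : ∀ d {ℓ i} → i < ℓ → quasiGreedy d ℓ i ≡ d i
quasiGreedy-< d {ℓ} {i} i<ℓ
  rewrite m<n⇒m%n≡m (m<n⇒m<1+n i<ℓ) | dec-false (i ≟ ℓ) (<⇒≢ i<ℓ) = refl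

quasiGreedy-last : ∀ d ℓ → quasiGreedy d ℓ ℓ ≡ pred (d ℓ)
quasiGreedy-last d ℓ rewrite m<n⇒m%n≡m (n<1+n ℓ) | dec-true (ℓ ≟ ℓ) refl = refl

quasiGreedy-periodic : ∀ d ℓ i → quasiGreedy d ℓ (suc ℓ + i) ≡ quasiGreedy d ℓ i
quasiGreedy-periodic d ℓ i =
  cong (lowerLast d ℓ) (trans (cong (_% suc ℓ) (+-comm (suc ℓ) i)) ([m+n]%n≡m%n i (suc ℓ)))

quasiGreedy-shift-mod : ∀ d ℓ j i →
                        shift j (quasiGreedy d ℓ) i ≡ shift (j % suc ℓ) (quasiGreedy d ℓ) i
quasiGreedy-shift-mod d ℓ j i = cong (lowerLast d ℓ) (begin
  (j + i) % p                    ≡⟨ %-distribˡ-+ j i p ⟩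
  (j % p + i % p) % p            ≡⟨ cong (λ x → (x + i % p) % p) (m%n%n≡m%n j p) ⟨
  (j % p % p + i % p) % p        ≡⟨ %-distribˡ-+ (j % p) i p ⟨
  (j % p + i) % p                ∎)
  where
  open ≡-Reasoning
  p : ℕ
  p = suc ℓ

FinRec⇒ConvRec : ∀ {d ℓ U} → d ℓ ≢ 0 → FinRec d (suc ℓ) U → ConvRec (quasiGreedy d ℓ) U
FinRec⇒ConvRec {d} {ℓ} {U} dℓ≢0 (U₀≡1 , initial , rec) =
  ConvRec-by-induction {d*} (suc ℓ) U₀≡1 initial* large
  where
  d* : ℕ → ℕ
  d* = quasiGreedy d ℓ
  initial* : ∀ i → 1 ≤ i → i < suc ℓ → U i ≡ conv d* U i i + 1
  initial* i 1≤i i≤ℓ = trans (initial i 1≤i i≤ℓ) (cong (_+ 1)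
    (conv-cong U i i (λ j j<i → sym (quasiGreedy-< d (<-≤-trans j<i (m<1+n⇒m≤n i≤ℓ))))))
  large : ∀ q → (∀ {n} → n < suc ℓ + q → U n ≡ conv d* U n n + 1) →
          U (suc ℓ + q) ≡ conv d* U (suc ℓ + q) (suc ℓ + q) + 1
  large q ih = begin
    U n
      ≡⟨ rec n (m≤m+n (suc ℓ) q) ⟩
    conv d U n ℓ + d ℓ * U (n ∸ suc ℓ)
      ≡⟨ cong (λ x → C + d ℓ * U x) (m+n∸m≡n ℓ q) ⟩
    C + d ℓ * U q
      ≡⟨ cong (λ x → C + x * U q) (suc-pred (d ℓ) {{≢-nonZero dℓ≢0}}) ⟨
    C + (U q + pred (d ℓ) * U q)
      ≡⟨ cong (λ x → C + (x + pred (d ℓ) * U q)) (ih (m<n+m q z<s)) ⟩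
    C + (conv d* U q q + 1 + pred (d ℓ) * U q)
      ≡⟨ rearrange C (conv d* U q q) _ ⟩
    C + pred (d ℓ) * U q + conv d* U q q + 1
      ≡⟨ cong₂ (λ x y → x + y * U q + conv d* U q q + 1) head last ⟩
    conv d* U n ℓ + d* ℓ * U q + conv d* U q q + 1
      ≡⟨ cong (λ x → conv d* U n ℓ + d* ℓ * U q + x + 1) tail ⟩
    conv d* U n ℓ + d* ℓ * U q + conv (shift (suc ℓ) d*) U q q + 1
      ≡⟨ cong (_+ 1) (conv-split-at d* U ℓ q) ⟨
    conv d* U n n + 1
      ∎
    where
    open ≡-Reasoning
    n C : ℕ
    n = suc ℓ + q
    C = conv d U n ℓ
    head : C ≡ conv d* U n ℓ
    head = conv-cong U n ℓ (λ j j<ℓ → sym (quasiGreedy-< d j<ℓ))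
    last : pred (d ℓ) ≡ d* ℓ
    last = sym (quasiGreedy-last d ℓ)
    tail : conv d* U q q ≡ conv (shift (suc ℓ) d*) U q q
    tail = conv-cong U q q (λ i _ → sym (quasiGreedy-periodic d ℓ i))
    rearrange : ∀ c x y → c + (x + 1 + y) ≡ c + y + x + 1
    rearrange = solve-∀

LexLt-congˡ : ∀ {a a′ b} → (∀ i → a i ≡ a′ i) → LexLt a′ b → LexLt a b
LexLt-congˡ {b = b} a≡a′ (n , agree , a′ₙ<bₙ) =
  n , (λ i i<n → trans (a≡a′ i) (agree i i<n)) , subst (_< b n) (sym (a≡a′ n)) a′ₙ<bₙ

-- The comparison of shift J d with d is decided before position r, or reaches it; there d*
-- carries the lowered last digit d (J + r) − 1 < d (J + r) ≤ d r.
quasiGreedy-LexLt : ∀ {d} J r → 1 ≤ J → d (J + r) ≢ 0 → LexLe (shift J d) d →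
                    LexLt (shift J (quasiGreedy d (J + r))) (quasiGreedy d (J + r))
quasiGreedy-LexLt {d} J r 1≤J d[J+r]≢0 lex = from-comparison (LexLe-at lex r)
  where
  d* : ℕ → ℕ
  d* = quasiGreedy d (J + r)
  top : ∀ {i} → i < r → d* (J + i) ≡ d (J + i)
  top i<r = quasiGreedy-< d (+-monoʳ-< J i<r)
  bottom : ∀ {i} → i ≤ r → d* i ≡ d i
  bottom i≤r = quasiGreedy-< d (≤-<-trans i≤r (m<n+m r 1≤J))
  agree* : ∀ {n} → n ≤ r → AgreeBelow n (shift J d) d → AgreeBelow n (shift J d*) d*
  agree* n≤r agree i i<n =
    trans (top (<-≤-trans i<n n≤r)) (trans (agree i i<n) (sym (bottom (<⇒≤ (<-≤-trans i<n n≤r)))))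
  last< : d (J + r) ≤ d r → d* (J + r) < d* r
  last< d[J+r]≤d[r] = begin-strict
    d* (J + r)         ≡⟨ quasiGreedy-last d (J + r) ⟩
    pred (d (J + r))   <⟨ ≤-reflexive (suc-pred (d (J + r)) {{≢-nonZero d[J+r]≢0}}) ⟩
    d (J + r)          ≤⟨ d[J+r]≤d[r] ⟩
    d r                ≡⟨ bottom ≤-refl ⟨
    d* r               ∎
    where open ≤-Reasoning
  from-comparison : LexLtWithin r (shift J d) d ⊎ (AgreeBelow r (shift J d) d × d (J + r) ≤ d r) →
                    LexLt (shift J d*) d*
  from-comparison (inj₁ (n , n<r , agree , lt)) =
    n , agree* (<⇒≤ n<r) agree , subst₂ _<_ (sym (top n<r)) (sym (bottom (<⇒≤ n<r))) lt
  from-comparison (inj₂ (agree , d[J+r]≤d[r])) = r , agree* ≤-refl agree , last< d[J+r]≤d[r]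

quasiGreedy-dominates : ∀ {d ℓ} → DominatesShifts d → d ℓ ≢ 0 → DominatesShifts (quasiGreedy d ℓ)
quasiGreedy-dominates {d} {ℓ} dom dℓ≢0 j
  with j % suc ℓ | m%n<n j (suc ℓ) | quasiGreedy-shift-mod d ℓ j
... | zero   | _      | reduce = inj₁ reduce
... | suc j′ | j′<ℓ | reduce with m≤n⇒∃[o]m+o≡n (m<1+n⇒m≤n j′<ℓ)
... | r , refl =
  inj₂ (LexLt-congˡ reduce (quasiGreedy-LexLt (suc j′) r (s≤s z≤n) dℓ≢0 (dom (suc j′))))

-- Ultimately periodic sequences

Periodic-iterate : ∀ {d a q} → Periodic d a q → ∀ {i} → a ≤ i → ∀ t → d (i + t * q) ≡ d i
Periodic-iterate {d} per {i} a≤i zero = cong d (+-identityʳ i)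
Periodic-iterate {d} {q = q} per@(_ , step) {i} a≤i (suc t) = begin
  d (i + (q + t * q))  ≡⟨ cong d (+-assoc i q (t * q)) ⟨
  d (i + q + t * q)    ≡⟨ cong d (xy∙z≈xz∙y i q (t * q)) ⟩
  d (i + t * q + q)    ≡⟨ step (i + t * q) (≤-trans a≤i (m≤m+n i (t * q))) ⟩
  d (i + t * q)        ≡⟨ Periodic-iterate per a≤i t ⟩
  d i                  ∎
  where open ≡-Reasoning

Periodic-transfer : ∀ {d a p b q} → Periodic d a p → Periodic d b q → Periodic d b p
Periodic-transfer {d} {a} {p} {q = q} (1≤p , stepA) perB@(s≤s z≤n , _) = 1≤p , λ i b≤i → begin
  d (i + p)            ≡⟨ Periodic-iterate perB (≤-trans b≤i (m≤m+n i p)) a ⟨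
  d (i + p + a * q)    ≡⟨ cong d (xy∙z≈xz∙y i p (a * q)) ⟩
  d (i + a * q + p)    ≡⟨ stepA (i + a * q) (≤-trans (m≤m*n a q) (m≤n+m (a * q) i)) ⟩
  d (i + a * q)        ≡⟨ Periodic-iterate perB b≤i a ⟩
  d i                  ∎
  where open ≡-Reasoning

window-induction : ∀ {P : ℕ → Set} c k → 1 ≤ k → (∀ i → c ≤ i → P i → P (i + k)) →
                   (∀ i → c ≤ i → i < c + k → P i) → ∀ i → c ≤ i → P i
window-induction {P} c k 1≤k step window = <-rec _ go
  where
  go : ∀ i → (∀ {i′} → i′ < i → c ≤ i′ → P i′) → c ≤ i → P i
  go i ih c≤i with i <? c + k
  ... | yes i<c+k = window i c≤i i<c+k
  ... | no  i≮c+k with m≤n⇒∃[o]m+o≡n (≮⇒≥ i≮c+k)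
  ... | o , refl = subst P (xy∙z≈xz∙y c o k)
                     (step (c + o) (m≤m+n c o) (ih (+-monoˡ-< o (m<m+n c 1≤k)) (m≤m+n c o)))

least-witness : ∀ {P : ℕ → Set} → (∀ n → Dec (P n)) → ∀ {n} → P n →
                ∃ λ k → P k × (∀ j → j < k → ¬ P j)
least-witness {P} P? {n} = <-rec _ search n
  where
  search : ∀ n → (∀ {n′} → n′ < n → P n′ → ∃ λ k → P k × (∀ j → j < k → ¬ P j)) →
           P n → ∃ λ k → P k × (∀ j → j < k → ¬ P j)
  search n ih Pn with anyUpTo? P? n
  ... | yes (k , k<n , Pk) = ih k<n Pk
  ... | no  none           = n , Pn , λ j j<n Pj → none (j , j<n , Pj)

eventually-zero⇒FiniteAt : ∀ {d} M → d 0 ≢ 0 → (∀ i → M ≤ i → d i ≡ 0) →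
                           ∃ λ m → FiniteAt d m
eventually-zero⇒FiniteAt zero d₀≢0 zero-from-M = contradiction (zero-from-M 0 z≤n) d₀≢0
eventually-zero⇒FiniteAt {d} (suc M) d₀≢0 zero-from-1+M with d M ≟ 0
... | no  d[M]≢0 = suc M , s≤s z≤n , d[M]≢0 , zero-from-1+M
... | yes d[M]≡0 = eventually-zero⇒FiniteAt M d₀≢0 zero-from-M
  where
  zero-from-M : ∀ i → M ≤ i → d i ≡ 0
  zero-from-M i M≤i with m≤n⇒m<n∨m≡n M≤i
  ... | inj₁ M<i  = zero-from-1+M i M<i
  ... | inj₂ refl = d[M]≡0

-- An ultimately periodic d is determined by finitely many of its values, which makes
-- periodicity decidable and lets minimal preperiod and period be found by search.
module _ {d m₀ k₀} (per₀ : Periodic d m₀ k₀) where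

  Periodic? : ∀ b p → Dec (Periodic d b p)
  Periodic? b zero = no λ ()
  Periodic? b p@(suc _) with allUpTo? (λ i → b ≤? i →-dec d (i + p) ≟ d i) (b + m₀ + k₀)
  ... | no  ¬window = no λ (_ , step) → ¬window λ _ b≤i → step _ b≤i
  ... | yes window  = yes (s≤s z≤n , periodic)
    where
    step₀ : ∀ i → m₀ ≤ i → d (i + k₀) ≡ d i
    step₀ = proj₂ per₀
    shift-window : ∀ i → b + m₀ ≤ i → d (i + p) ≡ d i → d (i + k₀ + p) ≡ d (i + k₀)
    shift-window i b+m₀≤i eq = let m₀≤i = ≤-trans (m≤n+m m₀ b) b+m₀≤i in begin
      d (i + k₀ + p)  ≡⟨ cong d (xy∙z≈xz∙y i k₀ p) ⟩
      d (i + p + k₀)  ≡⟨ step₀ (i + p) (≤-trans m₀≤i (m≤m+n i p)) ⟩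
      d (i + p)       ≡⟨ eq ⟩
      d i             ≡⟨ step₀ i m₀≤i ⟨
      d (i + k₀)      ∎
      where open ≡-Reasoning
    periodic : ∀ i → b ≤ i → d (i + p) ≡ d i
    periodic i b≤i with b + m₀ ≤? i
    ... | yes b+m₀≤i = window-induction (b + m₀) k₀ (proj₁ per₀) shift-window in-window i b+m₀≤i
      where
      in-window : ∀ i → b + m₀ ≤ i → i < b + m₀ + k₀ → d (i + p) ≡ d i
      in-window i b+m₀≤i i<b+m₀+k₀ = window i<b+m₀+k₀ (≤-trans (m≤m+n b m₀) b+m₀≤i)
    ... | no  b+m₀≰i = window (<-≤-trans (≰⇒> b+m₀≰i) (m≤m+n (b + m₀) k₀)) b≤i

  ∃-MinPeriodic : ∃₂ λ m k → MinPeriodic d m k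
  ∃-MinPeriodic with least-witness (Periodic? m₀) per₀
  ... | k , perₖ , k-least with least-witness (λ m → Periodic? m k) perₖ
  ... | m , perₘₖ , m-least = m , k , perₘₖ , λ m′ k′ per′ →
        ≮⇒≥ (λ m′<m → m-least m′ m′<m (Periodic-transfer perₘₖ per′)) ,
        ≮⇒≥ (λ k′<k → k-least k′ k′<k (Periodic-transfer per′ per₀))

  finite? : d 0 ≢ 0 → Dec (∃ λ m → FiniteAt d m)
  finite? d₀≢0 with anyUpTo? (λ i → ¬? (d (m₀ + i) ≟ 0)) k₀
  ... | yes (i , _ , d[m₀+i]≢0) = no λ (m , _ , _ , zero-from-m) → d[m₀+i]≢0 (begin
    d (m₀ + i)           ≡⟨ Periodic-iterate per₀ (m≤m+n m₀ i) m ⟨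
    d (m₀ + i + m * k₀)  ≡⟨ zero-from-m _ (≤-trans (m≤m*n m k₀ {{k₀≢0}}) (m≤n+m _ _)) ⟩
    0                    ∎)
    where
    open ≡-Reasoning
    k₀≢0 : NonZero k₀
    k₀≢0 = >-nonZero (proj₁ per₀)
  ... | no  none =
    yes (eventually-zero⇒FiniteAt m₀ d₀≢0 (window-induction m₀ k₀ (proj₁ per₀) step window))
    where
    step : ∀ i → m₀ ≤ i → d i ≡ 0 → d (i + k₀) ≡ 0
    step i m₀≤i dᵢ≡0 = trans (proj₂ per₀ i m₀≤i) dᵢ≡0
    window : ∀ i → m₀ ≤ i → i < m₀ + k₀ → d i ≡ 0
    window i m₀≤i i<m₀+k₀ with m≤n⇒∃[o]m+o≡n m₀≤i
    ... | j , refl = decidable-stable (d (m₀ + j) ≟ 0) λ d[m₀+j]≢0 →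
                       none (j , +-cancelˡ-< m₀ _ _ i<m₀+k₀ , d[m₀+j]≢0)

-- Growth of U_β

Parry⇒U-growth : ∀ {d U} → DominatesShifts d → d 0 ≢ 0 → IsParryNumber d → IsU d U →
                 ∀ n → U (suc n) ≤ suc (d 0) * U n
Parry⇒U-growth {d} dom d₀≢0 (_ , _ , per₀) (finRec , perRec) with finite? per₀ d₀≢0
... | yes (zero , () , _)
... | yes (suc ℓ , fin@(_ , dℓ≢0 , _)) =
  ConvRec⇒U-growth {quasiGreedy d ℓ} (FinRec⇒ConvRec {d} dℓ≢0 (finRec (suc ℓ) fin))
    (quasiGreedy-dominates {d} dom dℓ≢0) (lowerLast-≤ d ℓ 0)
... | no infinite with ∃-MinPeriodic per₀
... | m , k , minPer =
  ConvRec⇒U-growth {d} (PerRec⇒ConvRec (proj₁ minPer) (perRec m k infinite minPer)) dom ≤-refl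

IsDBeta1⇒head≢0 : ∀ {d} → IsDBeta1 d → d 0 ≢ 0
IsDBeta1⇒head≢0 (inj₁ ((1≤d₀ , _ , _) , _)) = >⇒≢ 1≤d₀
IsDBeta1⇒head≢0 (inj₂ (_ , 1≤N , constant)) = >⇒≢ 1≤N ∘ trans (sym (constant 0))

IsDBeta1⇒DominatesShifts : ∀ {d} → IsDBeta1 d → DominatesShifts d
IsDBeta1⇒DominatesShifts (inj₁ _)                   zero    = inj₁ λ _ → refl
IsDBeta1⇒DominatesShifts (inj₁ ((_ , lex , _) , _)) (suc j) = inj₂ (lex (suc j) (s≤s z≤n))
IsDBeta1⇒DominatesShifts (inj₂ (_ , _ , constant)) j =
  inj₁ λ i → trans (constant (j + i)) (sym (constant i))

IsP-unique : ∀ {U u v p p′} → IsP U u v p → IsP U u v p′ → p ≡ p′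
IsP-unique {p = p} {p′} (quot , minimal) (quot′ , minimal′) with <-cmp p p′
... | tri< p<p′ _ _ = contradiction quot (minimal′ p p<p′)
... | tri≈ _ p≡p′ _ = p≡p′
... | tri> _ _ p′<p = contradiction quot′ (minimal p′ p′<p)

corollary28 : (d : ℕ → ℕ) → IsDBeta1 d → IsParryNumber d →
    (U : ℕ → ℕ) → IsU d U →
    (u v : Word) → InL U u → InL U v → u ≢ [] → v ≢ [] →
    Star d U u v →
    (p : ℕ) → IsP U u v p →
    (w : Word) → InZL U w →
    binom (u ++ zeros p ++ w) (v ++ zeros p ++ w) % 2 ≡ 1
corollary28 _ _ _ _ _ _ _ _ _ u≢[] _ (inj₁ (u≡[] , _)) _ _ _ _ = contradiction u≡[] u≢[]
corollary28 d dβ parry U isU u v _ _ _ _ (inj₂ (_ , _ , p′ , isP′ , odd , no-extension)) p isP w w∈0*L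
  with IsP-unique {U} {u} {v} isP isP′
... | refl = begin
  binom (u ++ zeros p ++ w) (v ++ zeros p ++ w) % 2
    ≡⟨ cong₂ (λ x y → binom x y % 2) (++-assoc u (zeros p) w) (++-assoc v (zeros p) w) ⟨
  binom ((u ++ zeros p) ++ w) ((v ++ zeros p) ++ w) % 2
    ≡⟨ cong (_% 2) (binom-++-common-suffix (u ++ zeros p) (v ++ zeros p) w
                      (All.map no-extension′ digits)) ⟩
  binom (u ++ zeros p) (v ++ zeros p) % 2
    ≡⟨ odd ⟩
  1 ∎
  where
  open ≡-Reasoning
  digits : All (_≤ d 0) w
  digits = 0*L-digits-≤
    (Parry⇒U-growth (IsDBeta1⇒DominatesShifts dβ) (IsDBeta1⇒head≢0 dβ) parry isU) w∈0*L
  no-extension′ : ∀ {a} → a ≤ d 0 → binom (u ++ zeros p) ((v ++ zeros p) ++ a ∷ []) ≡ 0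
  no-extension′ {a} a≤t₁ =
    trans (cong (binom (u ++ zeros p)) (++-assoc v (zeros p) (a ∷ []))) (no-extension a a≤t₁)
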